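{- Fix odd integers $t,l\ge1$, an odd prime $p$, and an integer $k$ with $0\le k\le\lfloor t/2\rfloor$. There is an integer $x$ (independent of $a,b,n$) such that for all integers $0\le a\le b$ and $n\ge0$, with $r=p^a(p-1)+l$ and $s=p^b(p-1)+l$, $$(1-p^r)\binom{t}{2k}\frac{n!\,S_r^{(n+1)}(2k)!}{k!(-24)^k}\equiv(1-p^s)\binom{t}{2k}\frac{n!\,S_s^{(n+1)}(2k)!}{k!(-24)^k}\pmod{p^{a+x+1}}.$$
   Context: $S_m^{(n+1)}=\frac1{n!}\sum_{j\ge0}\binom{n}{j}(-1)^{n+j}(j+1)^{m-1}$ (Stirling numbers of the second kind). A congruence $u\equiv v\pmod{p^N}$ between rational numbers means that the $p$-adic valuation of $u-v$ is at least $N$. -}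

module Defs where

open import Data.Nat as ℕ using (ℕ; zero; suc; _∸_; _≤_)
open import Data.Nat.Properties using (_!≢0; m^n≢0; m*n≢0)
open import Data.Nat.Combinatorics using (_C_)
open import Data.Nat.Divisibility using (_∣_)
open import Data.Nat.Primality using (Prime)
open import Data.Integer as ℤ using (ℤ; +_; -[1+_])
open import Data.Rational using (ℚ; _/_; _+_; _*_; _-_; 0ℚ; 1ℚ)
open import Data.List using (List; map; foldr; upTo)
open import Data.Product using (Σ; ∃; _×_)
open import Relation.Nullary using (¬_)
open import Relation.Binary.PropositionalEquality using (_≡_)

ℕq : ℕ → ℚ
ℕq n = (+ n) / 1

ℤq : ℤ → ℚ
ℤq z = z / 1

qpow : ℚ → ℕ → ℚ
qpow q zero    = 1ℚ
qpow q (suc n) = q * qpow q n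

sumℚ : List ℚ → ℚ
sumℚ = foldr _+_ 0ℚ

inv! : ℕ → ℚ
inv! n = _/_ (+ 1) (n ℕ.!) {{n !≢0}}

-- S_m^{(n+1)} = (1/n!) Σ_{j=0}^{n} C(n,j) (-1)^{n+j} (j+1)^{m-1}
-- (only used with m ≥ 1, so m ∸ 1 = m - 1)
S : (m n : ℕ) → ℚ
S m n = inv! n * sumℚ (map term (upTo (suc n)))
  where
  term : ℕ → ℚ
  term j = ℕq (n C j) * qpow (ℤq (ℤ.- (+ 1))) (n ℕ.+ j) * qpow (ℕq (suc j)) (m ∸ 1)

-- 1 / (k! (-24)^k)  =  (-1)^k / (k! 24^k)
invK : ℕ → ℚ
invK k = qpow (ℤq (ℤ.- (+ 1))) k * _/_ (+ 1) (k ℕ.! ℕ.* 24 ℕ.^ k) {{nz}}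
  where
  nz : ℕ.NonZero (k ℕ.! ℕ.* 24 ℕ.^ k)
  nz = m*n≢0 (k ℕ.!) (24 ℕ.^ k) {{k !≢0}} {{m^n≢0 24 k}}

-- v_p(q) ≥ N  (N ∈ ℤ):  q ∈ p^N ℤ_(p), i.e. q = p^N · c/d with c ∈ ℤ, d ∈ ℕ, p ∤ d
PowDiv : ℕ → ℤ → ℚ → Set
PowDiv p (+ n)     q = Σ ℤ λ c → Σ ℕ λ d → (¬ p ∣ d) × (q * ℕq d ≡ ℤq c * qpow (ℕq p) n)
PowDiv p -[1+ n ]  q = Σ ℤ λ c → Σ ℕ λ d → (¬ p ∣ d) × (q * ℕq d * qpow (ℕq p) (suc n) ≡ ℤq c)

CongQ : ℕ → ℤ → ℚ → ℚ → Set
CongQ p N u v = PowDiv p N (u - v)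

Odd : ℕ → Set
Odd t = Σ ℕ λ m → t ≡ 2 ℕ.* m ℕ.+ 1

E : (p t k m n : ℕ) → ℚ
E p t k m n = (1ℚ - qpow (ℕq p) m) * ℕq (t C (2 ℕ.* k)) * (ℕq (n ℕ.!) * S m n)
              * ℕq ((2 ℕ.* k) ℕ.!) * invK k

-- Write E_m = (1 - p^m) · n! S_m^{(n+1)} · C(t,2k) (2k)! / (k! (-24)^k). The first two factors
-- form an integer Y_m, and n! S_m^{(n+1)} = Σ_j ± C(n,j) (j+1)^(m-1). For r and s as in the
-- statement, r - 1 and s - 1 exceed a and differ by a multiple of φ(p^(a+1)) = p^a (p-1), so
-- (j+1)^(r-1) ≡ (j+1)^(s-1) mod p^(a+1): by Euler's theorem when p ∤ j+1, trivially otherwise.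
-- Also p^(a+1) divides p^r and p^s, hence p^(a+1) ∣ Y_r - Y_s. The last factor is c/(p^e d)
-- with c, d integers, p ∤ d and p^e the exact power of p in k! 24^k, so x = -e works.
-- Euler's theorem for prime powers comes from Fermat's (via the binomial theorem) by lifting:
-- x ≡ 1 mod p^(i+1) implies x^p ≡ 1 mod p^(i+2).
module Submission where

open import Defs

open import Data.Empty using (⊥-elim)
open import Data.Fin as Fin using (toℕ; inject₁; fromℕ)
import Data.Fin.Properties as Fin
open import Data.Integer as ℤ using (ℤ; +_; -[1+_]; 0ℤ; 1ℤ; _⊖_)
open import Data.Integer.Divisibility.Signed as ℤ using (∣ᵤ⇒∣; ∣⇒∣ᵤ) renaming (_∣_ to _∣ℤ_)
import Data.Integer.Properties as ℤ
open import Data.Integer.Solver using (module +-*-Solver)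
open import Data.List using (List; []; _∷_; foldr; map; upTo)
open import Data.Nat as ℕ using (ℕ; zero; suc; 2+; _<_; _≤_; z≤n; s≤s; _!; _∸_)
open import Data.Nat.Combinatorics using (_C_; nCn≡1; nCk≡n!/k![n-k]!; k![n∸k]!∣n!)
open import Data.Nat.Divisibility as ℕ using (_∣_; _∤_)
open import Data.Nat.DivMod using (m*[n/m]≡n)
open import Data.Nat.Induction using (<-wellFounded)
open import Data.Nat.Primality using (Prime; euclidsLemma; prime⇒nonTrivial)
import Data.Nat.Properties as ℕ
import Data.Nat.Solver
open import Data.Product using (Σ; ∃; ∃₂; _×_; _,_)
open import Data.Rational as ℚ using (ℚ; 1ℚ)
import Data.Rational.Properties as ℚ
import Data.Rational.Solver
open import Data.Rational.Unnormalised as ℚᵘ using (mkℚᵘ; *≡*)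
import Data.Rational.Unnormalised.Properties as ℚᵘ
open import Data.Sum as Sum using (_⊎_; inj₁; inj₂)
open import Data.Vec.Functional using (Vector; init; tail)
open import Function using (_∘_)
open import Induction.WellFounded using (Acc; acc)
open import Relation.Binary.PropositionalEquality
open import Relation.Nullary using (yes; no)

open import Algebra.Properties.CommutativeSemiring.Binomial ℤ.+-*-commutativeSemiring
  using (binomialTerm; theorem)
open import Algebra.Properties.Semiring.Exp ℤ.+-*-semiring using () renaming (_^_ to _^ᴿ_)
open import Algebra.Properties.Semiring.Mult ℤ.+-*-semiring using () renaming (_×_ to _·_)
open import Algebra.Properties.Semiring.Sum ℤ.+-*-semiring using (sum; sum-init-last)

module NS = Data.Nat.Solver.+-*-Solver
module QS = Data.Rational.Solver.+-*-Solver

module _ where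
  open import Data.Nat using (_+_; _*_; _^_)

  prime∤n! : ∀ {p n} → Prime p → n < p → p ∤ n !
  prime∤n! {n = zero} pp _ p∣1 = ℕ.nonTrivial⇒≢1 {{prime⇒nonTrivial pp}} (ℕ.∣1⇒≡1 p∣1)
  prime∤n! {n = suc n} pp n<p p∣n! with euclidsLemma (suc n) (n !) pp p∣n!
  ... | inj₁ p∣1+n = ℕ.<⇒≱ n<p (ℕ.∣⇒≤ p∣1+n)
  ... | inj₂ p∣n!  = prime∤n! pp (ℕ.<-trans (ℕ.n<1+n n) n<p) p∣n!

  nCk*[k!*[n∸k]!]≡n! : ∀ {n k} → k ≤ n → (n C k) * (k ! * (n ∸ k) !) ≡ n !
  nCk*[k!*[n∸k]!]≡n! {n} {k} k≤n = begin
    (n C k) * D      ≡⟨ cong (_* D) (nCk≡n!/k![n-k]! k≤n) ⟩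
    (n ! ℕ./ D) * D  ≡⟨ ℕ.*-comm (n ! ℕ./ D) D ⟩
    D * (n ! ℕ./ D)  ≡⟨ m*[n/m]≡n (k![n∸k]!∣n! k≤n) ⟩
    n !              ∎
    where
    open ≡-Reasoning
    D = k ! * (n ∸ k) !
    instance _ = ℕ.m*n≢0 (k !) ((n ∸ k) !) {{k ℕ.!≢0}} {{(n ∸ k) ℕ.!≢0}}

  prime∣pCk : ∀ {p k} → Prime p → 0 < k → k < p → p ∣ p C k
  prime∣pCk {p@(suc p-1)} {k} pp 0<k k<p
    with euclidsLemma (p C k) (k ! * (p ∸ k) !) pp
           (subst (p ∣_) (sym (nCk*[k!*[n∸k]!]≡n! (ℕ.<⇒≤ k<p))) (ℕ.m∣m*n (p-1 !)))
  ... | inj₁ p∣pCk = p∣pCk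
  ... | inj₂ p∣k!*[p∸k]! with euclidsLemma (k !) ((p ∸ k) !) pp p∣k!*[p∸k]!
  ...   | inj₁ p∣k!     = ⊥-elim (prime∤n! pp k<p p∣k!)
  ...   | inj₂ p∣[p∸k]! = ⊥-elim (prime∤n! pp (ℕ.∸-monoʳ-< 0<k (ℕ.<⇒≤ k<p)) p∣[p∸k]!)

  prime⇒1<p : ∀ {p} → Prime p → 1 < p
  prime⇒1<p {p} pp = ℕ.nonTrivial⇒n>1 p {{prime⇒nonTrivial pp}}

  n<p^n : ∀ {p} → 1 < p → ∀ n → n < p ^ n
  n<p^n 1<p zero = s≤s z≤n
  n<p^n {p} 1<p (suc n) = ℕ.<-≤-trans (ℕ.<-≤-trans (s≤s (n<p^n 1<p n)) (ℕ.m<m*n _ p 1<p))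
                                     (ℕ.≤-reflexive (ℕ.*-comm (p ^ n) p))
    where instance _ = ℕ.m^n≢0 p n {{ℕ.>-nonZero (ℕ.<-trans (s≤s z≤n) 1<p)}}

  -- Euler's totient of p ^ suc a, for p prime
  φ : ℕ → ℕ → ℕ
  φ p a = p ^ a * (p ∸ 1)

  a<φ : ∀ {p} → 1 < p → ∀ a → a < φ p a
  a<φ {p} 1<p a = ℕ.<-≤-trans (n<p^n 1<p a) (ℕ.m≤m*n (p ^ a) (p ∸ 1))
    where instance _ = ℕ.>-nonZero (ℕ.∸-monoˡ-< 1<p (ℕ.≤-refl {1}))

  φ[a+c]≡φ[a]+φ[a]*[p^c∸1] : ∀ {p} → 0 < p → ∀ a c → φ p (a + c) ≡ φ p a + φ p a * (p ^ c ∸ 1)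
  φ[a+c]≡φ[a]+φ[a]*[p^c∸1] {p} 0<p a c = begin
    p ^ (a + c) * (p ∸ 1)    ≡⟨ cong (_* (p ∸ 1)) (ℕ.^-distribˡ-+-* p a c) ⟩
    p ^ a * p ^ c * (p ∸ 1)  ≡⟨ cong (λ z → p ^ a * z * (p ∸ 1)) (sym 1+W≡p^c) ⟩
    p ^ a * suc W * (p ∸ 1)  ≡⟨ NS.solve 3 (λ x w q → x NS.:* (NS.con 1 NS.:+ w) NS.:* q NS.:=
                                                    x NS.:* q NS.:+ x NS.:* q NS.:* w) refl (p ^ a) W (p ∸ 1) ⟩
    φ p a + φ p a * W        ∎
    where
    open ≡-Reasoning
    W = p ^ c ∸ 1
    1+W≡p^c : suc W ≡ p ^ c
    1+W≡p^c = ℕ.m+[n∸m]≡n (ℕ.m^n>0 p {{ℕ.>-nonZero 0<p}} c)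

  a<[φ+l]∸1 : ∀ {p l} → 1 < p → 0 < l → ∀ a → a < (φ p a + l) ∸ 1
  a<[φ+l]∸1 {p} {l} 1<p 0<l a = subst (a <_) (sym (ℕ.+-∸-assoc (φ p a) 0<l))
    (ℕ.<-≤-trans (a<φ 1<p a) (ℕ.m≤m+n (φ p a) (l ∸ 1)))

  [φ[b]+l]∸1≡[φ[a]+l]∸1+φ[a]*w : ∀ {p l} → 1 < p → 0 < l → ∀ {a b} → a ≤ b →
    ∃ λ w → (φ p b + l) ∸ 1 ≡ (φ p a + l) ∸ 1 + φ p a * w
  [φ[b]+l]∸1≡[φ[a]+l]∸1+φ[a]*w {p} {l} 1<p 0<l {a} a≤b
    with c , refl ← ℕ.m≤n⇒∃[o]m+o≡n a≤b = W , (begin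
    (φ p (a + c) + l) ∸ 1        ≡⟨ ℕ.+-∸-assoc (φ p (a + c)) 0<l ⟩
    φ p (a + c) + (l ∸ 1)        ≡⟨ cong (_+ (l ∸ 1)) (φ[a+c]≡φ[a]+φ[a]*[p^c∸1] 0<p a c) ⟩
    φ p a + φ p a * W + (l ∸ 1)  ≡⟨ NS.solve 3 (λ x y z → x NS.:+ y NS.:+ z NS.:= x NS.:+ z NS.:+ y)
                                      refl (φ p a) (φ p a * W) (l ∸ 1) ⟩
    φ p a + (l ∸ 1) + φ p a * W  ≡⟨ cong (_+ φ p a * W) (sym (ℕ.+-∸-assoc (φ p a) 0<l)) ⟩
    (φ p a + l) ∸ 1 + φ p a * W  ∎)
    where
    open ≡-Reasoning
    W = p ^ c ∸ 1
    0<p = ℕ.<-trans (s≤s z≤n) 1<p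

  k!*24^k≢0 : ∀ k → ℕ.NonZero (k ! * 24 ^ k)
  k!*24^k≢0 k = ℕ.m*n≢0 (k !) (24 ^ k) {{k ℕ.!≢0}} {{ℕ.m^n≢0 24 k}}

  p-adicDecomposition : ∀ p .{{_ : ℕ.NonTrivial p}} n .{{_ : ℕ.NonZero n}} →
                        ∃₂ λ e d → n ≡ p ^ e * d × p ∤ d
  p-adicDecomposition p n = go n (<-wellFounded n)
    where
    go : ∀ n .{{_ : ℕ.NonZero n}} → Acc _<_ n → ∃₂ λ e d → n ≡ p ^ e * d × p ∤ d
    go n (acc rec) with p ℕ.∣? n
    ... | no p∤n = 0 , n , sym (ℕ.+-identityʳ n) , p∤n
    ... | yes p∣n@(ℕ.divides q n≡q*p) with go q {{ℕ.quotient≢0 p∣n}} (rec (ℕ.quotient-< p∣n))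
    ...   | e , d , q≡pᵉd , p∤d = suc e , d , eq , p∤d
      where
      eq : n ≡ p ^ suc e * d
      eq = trans n≡q*p (trans (cong (_* p) q≡pᵉd)
             (NS.solve 3 (λ x d p → x NS.:* d NS.:* p NS.:= p NS.:* x NS.:* d) refl (p ^ e) d p))

module _ where
  open import Data.Integer using (_+_; _-_; -_; _*_; _^_)
  open +-*-Solver

  ·≡* : ∀ n x → n · x ≡ + n * x
  ·≡* zero x = sym (ℤ.*-zeroˡ x)
  ·≡* (suc n) x = begin
    x + n · x         ≡⟨ cong (_+_ x) (·≡* n x) ⟩
    x + + n * x       ≡⟨ cong (_+ + n * x) (sym (ℤ.*-identityˡ x)) ⟩
    1ℤ * x + + n * x  ≡⟨ sym (ℤ.*-distribʳ-+ x 1ℤ (+ n)) ⟩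
    + suc n * x       ∎
    where open ≡-Reasoning

  ^ᴿ≡^ : ∀ x n → x ^ᴿ n ≡ x ^ n
  ^ᴿ≡^ x zero = refl
  ^ᴿ≡^ x (suc n) = cong (x *_) (^ᴿ≡^ x n)

  ∣⇒∣· : ∀ {d n} → d ∣ n → ∀ x → + d ∣ℤ n · x
  ∣⇒∣· {n = n} d∣n x = subst (_ ∣ℤ_) (sym (·≡* n x)) (ℤ.∣m⇒∣m*n {m = + n} x (∣ᵤ⇒∣ d∣n))

  ∣-sum : ∀ {d n} (f : Vector ℤ n) → (∀ i → d ∣ℤ f i) → d ∣ℤ sum f
  ∣-sum {n = zero} f d∣f = ℤ.divides 0ℤ refl
  ∣-sum {n = suc n} f d∣f = ℤ.∣m∣n⇒∣m+n (d∣f Fin.zero) (∣-sum (tail f) (d∣f ∘ Fin.suc))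

  p∣[x+1]^p-[x^p+1] : ∀ {p} → Prime p → ∀ x → + p ∣ℤ (x + 1ℤ) ^ p - (x ^ p + 1ℤ)
  p∣[x+1]^p-[x^p+1] {p@(2+ q)} pp x = subst (+ p ∣ℤ_) eq (∣-sum middle p∣middle)
    where
    t = binomialTerm x 1ℤ p
    middle = init (tail t)
    p∣middle : ∀ i → + p ∣ℤ middle i
    p∣middle i = ∣⇒∣· (prime∣pCk pp (s≤s z≤n) k<p) _
      where
      k<p : suc (toℕ (inject₁ i)) < p
      k<p = s≤s (subst (_< suc q) (sym (Fin.toℕ-inject₁ i)) (Fin.toℕ<n i))
    first-term : t Fin.zero ≡ 1ℤ
    first-term = trans (ℤ.+-identityʳ _) (trans (ℤ.*-identityˡ _) (trans (^ᴿ≡^ 1ℤ p) (ℤ.^-zeroˡ p)))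
    last-term : t (fromℕ p) ≡ x ^ p
    last-term = begin
      (p C toℕ (fromℕ p)) · (x ^ᴿ toℕ (fromℕ p) * 1ℤ ^ᴿ (p ∸ toℕ (fromℕ p)))
        ≡⟨ cong (λ k → (p C k) · (x ^ᴿ k * 1ℤ ^ᴿ (p ∸ k))) (Fin.toℕ-fromℕ p) ⟩
      (p C p) · (x ^ᴿ p * 1ℤ ^ᴿ (p ∸ p))
        ≡⟨ cong₂ (λ c e → c · (x ^ᴿ p * 1ℤ ^ᴿ e)) (nCn≡1 p) (ℕ.n∸n≡0 p) ⟩
      1 · (x ^ᴿ p * 1ℤ)
        ≡⟨ trans (ℤ.+-identityʳ _) (trans (ℤ.*-identityʳ _) (^ᴿ≡^ x p)) ⟩
      x ^ p ∎
      where open ≡-Reasoning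
    eq : sum middle ≡ (x + 1ℤ) ^ p - (x ^ p + 1ℤ)
    eq = sym (begin
      (x + 1ℤ) ^ p - (x ^ p + 1ℤ)
        ≡⟨ cong (_- (x ^ p + 1ℤ)) (trans (sym (^ᴿ≡^ (x + 1ℤ) p)) (theorem p x 1ℤ)) ⟩
      t Fin.zero + sum (tail t) - (x ^ p + 1ℤ)
        ≡⟨ cong (λ s → t Fin.zero + s - (x ^ p + 1ℤ)) (sum-init-last (tail t)) ⟩
      t Fin.zero + (sum middle + t (fromℕ p)) - (x ^ p + 1ℤ)
        ≡⟨ cong₂ (λ a b → a + (sum middle + b) - (x ^ p + 1ℤ)) first-term last-term ⟩
      1ℤ + (sum middle + x ^ p) - (x ^ p + 1ℤ)
        ≡⟨ solve 2 (λ m y → con 1ℤ :+ (m :+ y) :- (y :+ con 1ℤ) := m) refl (sum middle) (x ^ p) ⟩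
      sum middle ∎)
      where open ≡-Reasoning

  euclidsLemmaℤ : ∀ {p} → Prime p → ∀ x y → + p ∣ℤ x * y → + p ∣ℤ x ⊎ + p ∣ℤ y
  euclidsLemmaℤ {p} pp x y p∣xy = Sum.map ∣ᵤ⇒∣ ∣ᵤ⇒∣
    (euclidsLemma ℤ.∣ x ∣ ℤ.∣ y ∣ pp (subst (p ∣_) (ℤ.abs-* x y) (∣⇒∣ᵤ p∣xy)))

  p∣u^p-u : ∀ {p} → Prime p → ∀ u → + p ∣ℤ (+ u) ^ p - + u
  p∣u^p-u {suc _} pp zero = ℤ.divides 0ℤ refl
  p∣u^p-u {p} pp (suc u) = subst (+ p ∣ℤ_) eq
    (ℤ.∣m∣n⇒∣m+n (p∣[x+1]^p-[x^p+1] pp (+ u)) (p∣u^p-u pp u))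
    where
    eq : (+ u + 1ℤ) ^ p - ((+ u) ^ p + 1ℤ) + ((+ u) ^ p - + u) ≡ (+ suc u) ^ p - + suc u
    eq = begin
      (+ u + 1ℤ) ^ p - ((+ u) ^ p + 1ℤ) + ((+ u) ^ p - + u)
        ≡⟨ solve 3 (λ y x u → y :- (x :+ con 1ℤ) :+ (x :- u) := y :- (u :+ con 1ℤ)) refl
             ((+ u + 1ℤ) ^ p) ((+ u) ^ p) (+ u) ⟩
      (+ u + 1ℤ) ^ p - (+ u + 1ℤ)
        ≡⟨ cong (λ z → z ^ p - z) (ℤ.+-comm (+ u) 1ℤ) ⟩
      (+ suc u) ^ p - + suc u ∎
      where open ≡-Reasoning

  fermatsLittleTheorem : ∀ {p u} → Prime p → p ∤ u → + p ∣ℤ (+ u) ^ (p ∸ 1) - 1ℤ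
  fermatsLittleTheorem {p@(suc p-1)} {u} pp p∤u
    with euclidsLemmaℤ pp (+ u) ((+ u) ^ p-1 - 1ℤ) (subst (+ p ∣ℤ_) eq (p∣u^p-u pp u))
    where
    eq : (+ u) ^ p - + u ≡ + u * ((+ u) ^ p-1 - 1ℤ)
    eq = solve 2 (λ u v → u :* v :- u := u :* (v :- con 1ℤ)) refl (+ u) ((+ u) ^ p-1)
  ... | inj₁ p∣u = ⊥-elim (p∤u (∣⇒∣ᵤ p∣u))
  ... | inj₂ p∣u^[p-1]-1 = p∣u^[p-1]-1

  geometricSum : ℤ → ℕ → ℤ
  geometricSum x zero = 0ℤ
  geometricSum x (suc n) = 1ℤ + x * geometricSum x n

  x^n-1≡[x-1]*geometricSum : ∀ x n → x ^ n - 1ℤ ≡ (x - 1ℤ) * geometricSum x n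
  x^n-1≡[x-1]*geometricSum x zero = sym (ℤ.*-zeroʳ (x - 1ℤ))
  x^n-1≡[x-1]*geometricSum x (suc n) = begin
    x * x ^ n - 1ℤ
      ≡⟨ solve 2 (λ x y → x :* y :- con 1ℤ := x :* (y :- con 1ℤ) :+ (x :- con 1ℤ)) refl x (x ^ n) ⟩
    x * (x ^ n - 1ℤ) + (x - 1ℤ)
      ≡⟨ cong (λ z → x * z + (x - 1ℤ)) (x^n-1≡[x-1]*geometricSum x n) ⟩
    x * ((x - 1ℤ) * G) + (x - 1ℤ)
      ≡⟨ solve 2 (λ x g → x :* ((x :- con 1ℤ) :* g) :+ (x :- con 1ℤ) :=
                          (x :- con 1ℤ) :* (con 1ℤ :+ x :* g)) refl x G ⟩
    (x - 1ℤ) * (1ℤ + x * G) ∎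
    where
    open ≡-Reasoning
    G = geometricSum x n

  ∣x-1⇒∣geometricSum-n : ∀ {d x} n → d ∣ℤ x - 1ℤ → d ∣ℤ geometricSum x n - + n
  ∣x-1⇒∣geometricSum-n zero d∣x-1 = ℤ.divides 0ℤ refl
  ∣x-1⇒∣geometricSum-n {x = x} (suc n) d∣x-1 = subst (_ ∣ℤ_) eq
    (ℤ.∣m∣n⇒∣m+n (ℤ.∣n⇒∣m*n x (∣x-1⇒∣geometricSum-n n d∣x-1)) (ℤ.∣n⇒∣m*n (+ n) d∣x-1))
    where
    G = geometricSum x n
    eq : x * (G - + n) + + n * (x - 1ℤ) ≡ (1ℤ + x * G) - + suc n
    eq = solve 3 (λ x g n → x :* (g :- n) :+ n :* (x :- con 1ℤ) := (con 1ℤ :+ x :* g) :- (con 1ℤ :+ n))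
           refl x G (+ n)

  *-mono-∣ : ∀ {a b x y} → a ∣ℤ x → b ∣ℤ y → a * b ∣ℤ x * y
  *-mono-∣ {a} {b} (ℤ.divides q refl) (ℤ.divides r refl) =
    ℤ.divides (q * r) (solve 4 (λ a b q r → (q :* a) :* (r :* b) := (q :* r) :* (a :* b)) refl a b q r)

  ^-mono-∣ : ∀ {d x} → d ∣ℤ x → ∀ {m n} → m ≤ n → d ^ m ∣ℤ x ^ n
  ^-mono-∣ {x = x} d∣x {zero} {n} _ = ℤ.divides (x ^ n) (sym (ℤ.*-identityʳ _))
  ^-mono-∣ d∣x {suc m} {suc n} (s≤s m≤n) = *-mono-∣ d∣x (^-mono-∣ d∣x m≤n)

  ∣x-1⇒∣x^n-1 : ∀ {d x} n → d ∣ℤ x - 1ℤ → d ∣ℤ x ^ n - 1ℤ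
  ∣x-1⇒∣x^n-1 {x = x} n d∣x-1 =
    subst (_ ∣ℤ_) (sym (x^n-1≡[x-1]*geometricSum x n)) (ℤ.∣m⇒∣m*n (geometricSum x n) d∣x-1)

  ∣x-1⇒*∣x^n-1 : ∀ {d x} n → d ∣ℤ x - 1ℤ → + n ∣ℤ x - 1ℤ → d * + n ∣ℤ x ^ n - 1ℤ
  ∣x-1⇒*∣x^n-1 {x = x} n d∣x-1 n∣x-1 =
    subst (_ ∣ℤ_) (sym (x^n-1≡[x-1]*geometricSum x n)) (*-mono-∣ d∣x-1 n∣G)
    where
    G = geometricSum x n
    n∣G : + n ∣ℤ G
    n∣G = subst (_ ∣ℤ_) (solve 2 (λ g n → (g :- n) :+ n := g) refl G (+ n))
      (ℤ.∣m∣n⇒∣m+n (∣x-1⇒∣geometricSum-n n n∣x-1) ℤ.∣-refl)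

  eulersTheorem : ∀ {p u} → Prime p → p ∤ u → ∀ a → (+ p) ^ suc a ∣ℤ (+ u) ^ φ p a - 1ℤ
  eulersTheorem {p} {u} pp p∤u zero = subst₂ (λ d e → d ∣ℤ (+ u) ^ e - 1ℤ)
    (sym (ℤ.^-identityʳ (+ p))) (sym (ℕ.*-identityˡ (p ∸ 1))) (fermatsLittleTheorem pp p∤u)
  eulersTheorem {p} {u} pp p∤u (suc a) = subst₂ (λ d y → d ∣ℤ y - 1ℤ)
    (ℤ.*-comm ((+ p) ^ suc a) (+ p)) w^p≡ (∣x-1⇒*∣x^n-1 p p^[1+a]∣w-1 p∣w-1)
    where
    w = (+ u) ^ φ p a
    p^[1+a]∣w-1 = eulersTheorem pp p∤u a
    p∣w-1 : + p ∣ℤ w - 1ℤ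
    p∣w-1 = ℤ.∣-trans (ℤ.∣m⇒∣m*n ((+ p) ^ a) ℤ.∣-refl) p^[1+a]∣w-1
    w^p≡ : w ^ p ≡ (+ u) ^ φ p (suc a)
    w^p≡ = trans (ℤ.^-*-assoc (+ u) (φ p a) p)
      (cong ((+ u) ^_) (NS.solve 3 (λ x y p → x NS.:* y NS.:* p NS.:= p NS.:* x NS.:* y)
                          refl (p ℕ.^ a) (p ∸ 1) p))

  p^[1+a]∣u^i-u^[i+φw] : ∀ {p} → Prime p → ∀ a u {i} w → a < i →
    (+ p) ^ suc a ∣ℤ (+ u) ^ i - (+ u) ^ (i ℕ.+ φ p a ℕ.* w)
  p^[1+a]∣u^i-u^[i+φw] {p} pp a u {i} w a<i with p ℕ.∣? u
  ... | yes p∣u =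
    ℤ.∣m∣n⇒∣m-n (^-mono-∣ p∣u′ a<i) (^-mono-∣ p∣u′ (ℕ.≤-trans a<i (ℕ.m≤m+n i _)))
    where
    p∣u′ : + p ∣ℤ + u
    p∣u′ = ∣ᵤ⇒∣ p∣u
  ... | no p∤u =
    subst (_ ∣ℤ_) (sym eq)
      (ℤ.∣m⇒∣-m (ℤ.∣n⇒∣m*n ((+ u) ^ i) (∣x-1⇒∣x^n-1 w (eulersTheorem pp p∤u a))))
    where
    v = (+ u) ^ φ p a
    eq : (+ u) ^ i - (+ u) ^ (i ℕ.+ φ p a ℕ.* w) ≡ - ((+ u) ^ i * (v ^ w - 1ℤ))
    eq = begin
      (+ u) ^ i - (+ u) ^ (i ℕ.+ φ p a ℕ.* w)
        ≡⟨ cong (_-_ ((+ u) ^ i)) (ℤ.^-distribˡ-+-* (+ u) i _) ⟩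
      (+ u) ^ i - (+ u) ^ i * (+ u) ^ (φ p a ℕ.* w)
        ≡⟨ cong (λ z → (+ u) ^ i - (+ u) ^ i * z) (sym (ℤ.^-*-assoc (+ u) (φ p a) w)) ⟩
      (+ u) ^ i - (+ u) ^ i * v ^ w
        ≡⟨ solve 2 (λ x y → x :- x :* y := :- (x :* (y :- con 1ℤ))) refl ((+ u) ^ i) (v ^ w) ⟩
      - ((+ u) ^ i * (v ^ w - 1ℤ)) ∎
      where open ≡-Reasoning

  sumℤ : List ℤ → ℤ
  sumℤ = foldr _+_ 0ℤ

  ∣-sumℤ-map-diff : ∀ {d} {f g : ℕ → ℤ} → (∀ j → d ∣ℤ f j - g j) → ∀ xs →
                    d ∣ℤ sumℤ (map f xs) - sumℤ (map g xs)
  ∣-sumℤ-map-diff d∣f-g [] = ℤ.divides 0ℤ refl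
  ∣-sumℤ-map-diff {d} {f} {g} d∣f-g (x ∷ xs) = subst (d ∣ℤ_)
    (solve 4 (λ a b c e → (a :- b) :+ (c :- e) := (a :+ c) :- (b :+ e)) refl
       (f x) (g x) (sumℤ (map f xs)) (sumℤ (map g xs)))
    (ℤ.∣m∣n⇒∣m+n (d∣f-g x) (∣-sumℤ-map-diff d∣f-g xs))

  ℤq≃mkℚᵘ : ∀ a → ℚ.toℚᵘ (ℤq a) ℚᵘ.≃ mkℚᵘ a 0
  ℤq≃mkℚᵘ a = ℚ.toℚᵘ-fromℚᵘ (mkℚᵘ a 0)

  ℤq-homo-+ : ∀ a b → ℤq (a + b) ≡ ℤq a ℚ.+ ℤq b
  ℤq-homo-+ a b = ℚ.toℚᵘ-injective (ℚᵘ.≃-trans (ℤq≃mkℚᵘ (a + b)) (ℚᵘ.≃-sym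
    (ℚᵘ.≃-trans (ℚ.toℚᵘ-homo-+ (ℤq a) (ℤq b))
      (ℚᵘ.≃-trans (ℚᵘ.+-cong (ℤq≃mkℚᵘ a) (ℤq≃mkℚᵘ b))
        (*≡* (solve 2 (λ a b → (a :* con 1ℤ :+ b :* con 1ℤ) :* con 1ℤ := (a :+ b) :* con 1ℤ) refl a b))))))

  ℤq-homo-* : ∀ a b → ℤq (a * b) ≡ ℤq a ℚ.* ℤq b
  ℤq-homo-* a b = ℚ.toℚᵘ-injective (ℚᵘ.≃-trans (ℤq≃mkℚᵘ (a * b)) (ℚᵘ.≃-sym
    (ℚᵘ.≃-trans (ℚ.toℚᵘ-homo-* (ℤq a) (ℤq b))
      (ℚᵘ.≃-trans (ℚᵘ.*-cong (ℤq≃mkℚᵘ a) (ℤq≃mkℚᵘ b)) (*≡* refl)))))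

  ℤq-homo-neg : ∀ a → ℤq (- a) ≡ ℚ.- ℤq a
  ℤq-homo-neg a = ℚ.toℚᵘ-injective (ℚᵘ.≃-trans (ℤq≃mkℚᵘ (- a))
    (ℚᵘ.≃-sym (ℚᵘ.≃-trans (ℚ.toℚᵘ-homo‿- (ℤq a)) (ℚᵘ.-‿cong (ℤq≃mkℚᵘ a)))))

  ℤq-homo-sub : ∀ a b → ℤq (a - b) ≡ ℤq a ℚ.- ℤq b
  ℤq-homo-sub a b = trans (ℤq-homo-+ a (- b)) (cong (ℤq a ℚ.+_) (ℤq-homo-neg b))

  ℕq-homo-* : ∀ m n → ℕq (m ℕ.* n) ≡ ℕq m ℚ.* ℕq n
  ℕq-homo-* m n = trans (cong ℤq (ℤ.pos-* m n)) (ℤq-homo-* (+ m) (+ n))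

  qpow-ℤq : ∀ z n → qpow (ℤq z) n ≡ ℤq (z ^ n)
  qpow-ℤq z zero = refl
  qpow-ℤq z (suc n) = trans (cong (ℤq z ℚ.*_) (qpow-ℤq z n)) (sym (ℤq-homo-* z (z ^ n)))

  ℕq-homo-^ : ∀ m n → ℕq (m ℕ.^ n) ≡ qpow (ℕq m) n
  ℕq-homo-^ m zero = refl
  ℕq-homo-^ m (suc n) = trans (ℕq-homo-* m (m ℕ.^ n)) (cong (ℕq m ℚ.*_) (ℕq-homo-^ m n))

  qpow-+ : ∀ q m n → qpow q (m ℕ.+ n) ≡ qpow q m ℚ.* qpow q n
  qpow-+ q zero n = sym (ℚ.*-identityˡ _)
  qpow-+ q (suc m) n = trans (cong (q ℚ.*_) (qpow-+ q m n)) (sym (ℚ.*-assoc q _ _))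

  sumℚ-map-ℤq : ∀ {f : ℕ → ℚ} {g : ℕ → ℤ} → (∀ j → f j ≡ ℤq (g j)) → ∀ xs →
                sumℚ (map f xs) ≡ ℤq (sumℤ (map g xs))
  sumℚ-map-ℤq f≡g [] = refl
  sumℚ-map-ℤq {g = g} f≡g (x ∷ xs) =
    trans (cong₂ ℚ._+_ (f≡g x) (sumℚ-map-ℤq f≡g xs)) (sym (ℤq-homo-+ (g x) _))

  1/n*n≡1 : ∀ n .{{_ : ℕ.NonZero n}} → (+ 1 ℚ./ n) ℚ.* ℕq n ≡ 1ℚ
  1/n*n≡1 (suc n) = ℚ.toℚᵘ-injective (ℚᵘ.≃-trans (ℚ.toℚᵘ-homo-* (+ 1 ℚ./ suc n) (ℕq (suc n)))
    (ℚᵘ.≃-trans (ℚᵘ.*-cong (ℚ.toℚᵘ-fromℚᵘ (mkℚᵘ (+ 1) n)) (ℤq≃mkℚᵘ (+ suc n)))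
      (*≡* (trans (ℤ.*-identityʳ _) (trans (ℤ.*-identityˡ _)
        (trans (cong +_ (sym (ℕ.*-identityʳ (suc n)))) (sym (ℤ.*-identityˡ _))))))))

  [m+f]⊖m≡f : ∀ m f → (m ℕ.+ f) ⊖ m ≡ + f
  [m+f]⊖m≡f m f = trans (cong ((m ℕ.+ f) ⊖_) (sym (ℕ.+-identityʳ m))) (ℤ.+-cancelˡ-⊖ m f 0)

  m⊖[1+m+g]≡-[1+g] : ∀ m g → m ⊖ (suc m ℕ.+ g) ≡ -[1+ g ]
  m⊖[1+m+g]≡-[1+g] m g =
    trans (cong₂ _⊖_ (sym (ℕ.+-identityʳ m)) (sym (ℕ.+-suc m g))) (ℤ.+-cancelˡ-⊖ m 0 (suc g))

  [1+a]⊖e≡a-e+1 : ∀ a e → suc a ⊖ e ≡ + a + - + e + + 1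
  [1+a]⊖e≡a-e+1 a e = trans (sym (ℤ.[+m]-[+n]≡m⊖n (suc a) e))
    (solve 2 (λ a e → (con 1ℤ :+ a) :- e := a :+ :- e :+ con 1ℤ) refl (+ a) (+ e))

  PowDiv-intro : ∀ {p x u} c {d} m e → p ∤ d → x ℚ.* ℕq d ℚ.* qpow (ℕq p) e ≡ ℤq u →
                 PowDiv p (m ⊖ e) (ℤq c ℚ.* qpow (ℕq p) m ℚ.* x)
  PowDiv-intro {p} {x} {u} c {d} m e p∤d x*d*pᵉ≡u with ℕ.≤-<-connex e m
  ... | inj₁ e≤m with f , refl ← ℕ.m≤n⇒∃[o]m+o≡n e≤m =
    subst (λ N → PowDiv p N (ℤq c ℚ.* P (e ℕ.+ f) ℚ.* x)) (sym ([m+f]⊖m≡f e f)) (c * u , d , p∤d , eq)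
    where
    P = qpow (ℕq p)
    eq : ℤq c ℚ.* P (e ℕ.+ f) ℚ.* x ℚ.* ℕq d ≡ ℤq (c * u) ℚ.* P f
    eq = begin
      ℤq c ℚ.* P (e ℕ.+ f) ℚ.* x ℚ.* ℕq d
        ≡⟨ cong (λ z → ℤq c ℚ.* z ℚ.* x ℚ.* ℕq d) (qpow-+ (ℕq p) e f) ⟩
      ℤq c ℚ.* (P e ℚ.* P f) ℚ.* x ℚ.* ℕq d
        ≡⟨ QS.solve 5 (λ c a b x d → c QS.:* (a QS.:* b) QS.:* x QS.:* d QS.:=
                                    c QS.:* (x QS.:* d QS.:* a) QS.:* b) refl (ℤq c) (P e) (P f) x (ℕq d) ⟩
      ℤq c ℚ.* (x ℚ.* ℕq d ℚ.* P e) ℚ.* P f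
        ≡⟨ cong (λ z → ℤq c ℚ.* z ℚ.* P f) x*d*pᵉ≡u ⟩
      ℤq c ℚ.* ℤq u ℚ.* P f
        ≡⟨ cong (ℚ._* P f) (sym (ℤq-homo-* c u)) ⟩
      ℤq (c * u) ℚ.* P f ∎
      where open ≡-Reasoning
  ... | inj₂ m<e with g , refl ← ℕ.m≤n⇒∃[o]m+o≡n m<e =
    subst (λ N → PowDiv p N (ℤq c ℚ.* P m ℚ.* x)) (sym (m⊖[1+m+g]≡-[1+g] m g)) (c * u , d , p∤d , eq)
    where
    P = qpow (ℕq p)
    eq : ℤq c ℚ.* P m ℚ.* x ℚ.* ℕq d ℚ.* P (suc g) ≡ ℤq (c * u)
    eq = begin
      ℤq c ℚ.* P m ℚ.* x ℚ.* ℕq d ℚ.* P (suc g)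
        ≡⟨ QS.solve 5 (λ c a x d b → c QS.:* a QS.:* x QS.:* d QS.:* b QS.:=
                                    c QS.:* (x QS.:* d QS.:* (a QS.:* b))) refl (ℤq c) (P m) x (ℕq d) (P (suc g)) ⟩
      ℤq c ℚ.* (x ℚ.* ℕq d ℚ.* (P m ℚ.* P (suc g)))
        ≡⟨ cong (λ z → ℤq c ℚ.* (x ℚ.* ℕq d ℚ.* z))
                (trans (sym (qpow-+ (ℕq p) m (suc g))) (cong P (ℕ.+-suc m g))) ⟩
      ℤq c ℚ.* (x ℚ.* ℕq d ℚ.* P (suc m ℕ.+ g))
        ≡⟨ cong (ℤq c ℚ.*_) x*d*pᵉ≡u ⟩
      ℤq c ℚ.* ℤq u
        ≡⟨ sym (ℤq-homo-* c u) ⟩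
      ℤq (c * u) ∎
      where open ≡-Reasoning

  stirlingTerm : ℕ → ℕ → ℕ → ℤ
  stirlingTerm m n j = + (n C j) * (- 1ℤ) ^ (n ℕ.+ j) * (+ suc j) ^ (m ∸ 1)

  n!S : ℕ → ℕ → ℤ
  n!S m n = sumℤ (map (stirlingTerm m n) (upTo (suc n)))

  ℕq[n!]*S≡ℤq[n!S] : ∀ m n → ℕq (n !) ℚ.* S m n ≡ ℤq (n!S m n)
  ℕq[n!]*S≡ℤq[n!S] m n = begin
    ℕq (n !) ℚ.* (inv! n ℚ.* ∑)  ≡⟨ sym (ℚ.*-assoc (ℕq (n !)) (inv! n) ∑) ⟩
    ℕq (n !) ℚ.* inv! n ℚ.* ∑    ≡⟨ cong (ℚ._* ∑) n!*inv!n≡1 ⟩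
    1ℚ ℚ.* ∑                     ≡⟨ ℚ.*-identityˡ ∑ ⟩
    ∑                            ≡⟨ sumℚ-map-ℤq {g = stirlingTerm m n} termℚ≡ (upTo (suc n)) ⟩
    ℤq (n!S m n)                 ∎
    where
    open ≡-Reasoning
    termℚ : ℕ → ℚ
    termℚ j = ℕq (n C j) ℚ.* qpow (ℤq (- 1ℤ)) (n ℕ.+ j) ℚ.* qpow (ℕq (suc j)) (m ∸ 1)
    ∑ = sumℚ (map termℚ (upTo (suc n)))
    n!*inv!n≡1 : ℕq (n !) ℚ.* inv! n ≡ 1ℚ
    n!*inv!n≡1 = trans (ℚ.*-comm (ℕq (n !)) (inv! n)) (1/n*n≡1 (n !) {{n ℕ.!≢0}})
    termℚ≡ : ∀ j → termℚ j ≡ ℤq (stirlingTerm m n j)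
    termℚ≡ j = begin
      termℚ j
        ≡⟨ cong₂ (λ x y → ℕq (n C j) ℚ.* x ℚ.* y)
                 (qpow-ℤq (- 1ℤ) (n ℕ.+ j)) (qpow-ℤq (+ suc j) (m ∸ 1)) ⟩
      ℕq (n C j) ℚ.* ℤq ((- 1ℤ) ^ (n ℕ.+ j)) ℚ.* ℤq ((+ suc j) ^ (m ∸ 1))
        ≡⟨ cong (ℚ._* ℤq ((+ suc j) ^ (m ∸ 1))) (sym (ℤq-homo-* (+ (n C j)) ((- 1ℤ) ^ (n ℕ.+ j)))) ⟩
      ℤq (+ (n C j) * (- 1ℤ) ^ (n ℕ.+ j)) ℚ.* ℤq ((+ suc j) ^ (m ∸ 1))
        ≡⟨ sym (ℤq-homo-* (+ (n C j) * (- 1ℤ) ^ (n ℕ.+ j)) ((+ suc j) ^ (m ∸ 1))) ⟩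
      ℤq (stirlingTerm m n j) ∎

  E-integerPart : ℕ → ℕ → ℕ → ℤ
  E-integerPart p m n = (1ℤ - (+ p) ^ m) * n!S m n

  E-coefficient : ℕ → ℕ → ℚ
  E-coefficient t k = ℕq (t C (2 ℕ.* k)) ℚ.* ℕq ((2 ℕ.* k) !) ℚ.* invK k

  E-coefficientNumerator : ℕ → ℕ → ℤ
  E-coefficientNumerator t k = + (t C (2 ℕ.* k)) * + ((2 ℕ.* k) !) * (- 1ℤ) ^ k

  E≡ℤq[integerPart]*coefficient : ∀ p t k m n →
    E p t k m n ≡ ℤq (E-integerPart p m n) ℚ.* E-coefficient t k
  E≡ℤq[integerPart]*coefficient p t k m n = begin
    (1ℚ ℚ.- qpow (ℕq p) m) ℚ.* B ℚ.* (ℕq (n !) ℚ.* S m n) ℚ.* F ℚ.* I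
      ≡⟨ cong₂ (λ x y → x ℚ.* B ℚ.* y ℚ.* F ℚ.* I) 1-p^m≡ (ℕq[n!]*S≡ℤq[n!S] m n) ⟩
    ℤq (1ℤ - (+ p) ^ m) ℚ.* B ℚ.* ℤq (n!S m n) ℚ.* F ℚ.* I
      ≡⟨ QS.solve 5 (λ x c a f i → x QS.:* c QS.:* a QS.:* f QS.:* i QS.:= (x QS.:* a) QS.:* (c QS.:* f QS.:* i))
           refl (ℤq (1ℤ - (+ p) ^ m)) B (ℤq (n!S m n)) F I ⟩
    ℤq (1ℤ - (+ p) ^ m) ℚ.* ℤq (n!S m n) ℚ.* E-coefficient t k
      ≡⟨ cong (ℚ._* E-coefficient t k) (sym (ℤq-homo-* (1ℤ - (+ p) ^ m) (n!S m n))) ⟩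
    ℤq (E-integerPart p m n) ℚ.* E-coefficient t k ∎
    where
    open ≡-Reasoning
    B = ℕq (t C (2 ℕ.* k))
    F = ℕq ((2 ℕ.* k) !)
    I = invK k
    1-p^m≡ : 1ℚ ℚ.- qpow (ℕq p) m ≡ ℤq (1ℤ - (+ p) ^ m)
    1-p^m≡ = trans (cong (ℚ._-_ 1ℚ) (qpow-ℤq (+ p) m)) (sym (ℤq-homo-sub 1ℤ ((+ p) ^ m)))

  coefficient*[k!*24^k]≡numerator : ∀ t k →
    E-coefficient t k ℚ.* ℕq (k ! ℕ.* 24 ℕ.^ k) ≡ ℤq (E-coefficientNumerator t k)
  coefficient*[k!*24^k]≡numerator t k = begin
    B ℚ.* F ℚ.* (M ℚ.* u) ℚ.* ℕq D
      ≡⟨ QS.solve 5 (λ b f m u d → b QS.:* f QS.:* (m QS.:* u) QS.:* d QS.:= b QS.:* f QS.:* m QS.:* (u QS.:* d))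
           refl B F M u (ℕq D) ⟩
    B ℚ.* F ℚ.* M ℚ.* (u ℚ.* ℕq D)
      ≡⟨ cong (B ℚ.* F ℚ.* M ℚ.*_) (1/n*n≡1 D) ⟩
    B ℚ.* F ℚ.* M ℚ.* 1ℚ
      ≡⟨ ℚ.*-identityʳ _ ⟩
    B ℚ.* F ℚ.* M
      ≡⟨ cong (B ℚ.* F ℚ.*_) (qpow-ℤq (- 1ℤ) k) ⟩
    ℤq (+ (t C (2 ℕ.* k))) ℚ.* ℤq (+ ((2 ℕ.* k) !)) ℚ.* ℤq ((- 1ℤ) ^ k)
      ≡⟨ cong (ℚ._* ℤq ((- 1ℤ) ^ k)) (sym (ℤq-homo-* (+ (t C (2 ℕ.* k))) (+ ((2 ℕ.* k) !)))) ⟩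
    ℤq (+ (t C (2 ℕ.* k)) * + ((2 ℕ.* k) !)) ℚ.* ℤq ((- 1ℤ) ^ k)
      ≡⟨ sym (ℤq-homo-* (+ (t C (2 ℕ.* k)) * + ((2 ℕ.* k) !)) ((- 1ℤ) ^ k)) ⟩
    ℤq (E-coefficientNumerator t k) ∎
    where
    open ≡-Reasoning
    B = ℕq (t C (2 ℕ.* k))
    F = ℕq ((2 ℕ.* k) !)
    M = qpow (ℤq (- 1ℤ)) k
    D = k ! ℕ.* 24 ℕ.^ k
    instance _ = k!*24^k≢0 k
    u = + 1 ℚ./ D

  coefficient*d*pᵉ≡numerator : ∀ {p e d} t k → k ! ℕ.* 24 ℕ.^ k ≡ p ℕ.^ e ℕ.* d →
    E-coefficient t k ℚ.* ℕq d ℚ.* qpow (ℕq p) e ≡ ℤq (E-coefficientNumerator t k)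
  coefficient*d*pᵉ≡numerator {p} {e} {d} t k k!*24^k≡pᵉd = begin
    K ℚ.* ℕq d ℚ.* qpow (ℕq p) e
      ≡⟨ QS.solve 3 (λ x y z → x QS.:* z QS.:* y QS.:= x QS.:* (y QS.:* z)) refl K (qpow (ℕq p) e) (ℕq d) ⟩
    K ℚ.* (qpow (ℕq p) e ℚ.* ℕq d)
      ≡⟨ cong (K ℚ.*_) (sym (trans (ℕq-homo-* (p ℕ.^ e) d) (cong (ℚ._* ℕq d) (ℕq-homo-^ p e)))) ⟩
    K ℚ.* ℕq (p ℕ.^ e ℕ.* d)
      ≡⟨ cong (λ D → K ℚ.* ℕq D) (sym k!*24^k≡pᵉd) ⟩
    K ℚ.* ℕq (k ! ℕ.* 24 ℕ.^ k)
      ≡⟨ coefficient*[k!*24^k]≡numerator t k ⟩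
    ℤq (E-coefficientNumerator t k) ∎
    where
    open ≡-Reasoning
    K = E-coefficient t k

  E-difference : ∀ p t k r s n c m → E-integerPart p r n - E-integerPart p s n ≡ c * (+ p) ^ m →
    E p t k r n ℚ.- E p t k s n ≡ ℤq c ℚ.* qpow (ℕq p) m ℚ.* E-coefficient t k
  E-difference p t k r s n c m eq = begin
    E p t k r n ℚ.- E p t k s n
      ≡⟨ cong₂ ℚ._-_ (E≡ℤq[integerPart]*coefficient p t k r n) (E≡ℤq[integerPart]*coefficient p t k s n) ⟩
    ℤq Yr ℚ.* K ℚ.- ℤq Ys ℚ.* K
      ≡⟨ QS.solve 3 (λ x y k → x QS.:* k QS.:- y QS.:* k QS.:= (x QS.:- y) QS.:* k) refl (ℤq Yr) (ℤq Ys) K ⟩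
    (ℤq Yr ℚ.- ℤq Ys) ℚ.* K
      ≡⟨ cong (ℚ._* K) (sym (ℤq-homo-sub Yr Ys)) ⟩
    ℤq (Yr - Ys) ℚ.* K
      ≡⟨ cong (λ z → ℤq z ℚ.* K) eq ⟩
    ℤq (c * (+ p) ^ m) ℚ.* K
      ≡⟨ cong (ℚ._* K) (trans (ℤq-homo-* c ((+ p) ^ m)) (cong (ℤq c ℚ.*_) (sym (qpow-ℤq (+ p) m)))) ⟩
    ℤq c ℚ.* qpow (ℕq p) m ℚ.* K ∎
    where
    open ≡-Reasoning
    Yr = E-integerPart p r n
    Ys = E-integerPart p s n
    K = E-coefficient t k

  n!S-congruence : ∀ {p} → Prime p → ∀ {a r s} w → a < r ∸ 1 → s ∸ 1 ≡ r ∸ 1 ℕ.+ φ p a ℕ.* w →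
    ∀ n → (+ p) ^ suc a ∣ℤ n!S r n - n!S s n
  n!S-congruence {p} pp {a} {r} {s} w a<r∸1 s∸1≡ n =
    ∣-sumℤ-map-diff {f = stirlingTerm r n} {g = stirlingTerm s n} p^[1+a]∣term[r]-term[s] (upTo (suc n))
    where
    p^[1+a]∣term[r]-term[s] : ∀ j → (+ p) ^ suc a ∣ℤ stirlingTerm r n j - stirlingTerm s n j
    p^[1+a]∣term[r]-term[s] j =
      subst (_ ∣ℤ_) eq (ℤ.∣n⇒∣m*n κ (p^[1+a]∣u^i-u^[i+φw] pp a (suc j) w a<r∸1))
      where
      κ = + (n C j) * (- 1ℤ) ^ (n ℕ.+ j)
      eq : κ * ((+ suc j) ^ (r ∸ 1) - (+ suc j) ^ (r ∸ 1 ℕ.+ φ p a ℕ.* w)) ≡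
           stirlingTerm r n j - stirlingTerm s n j
      eq = trans (solve 3 (λ k x y → k :* (x :- y) := k :* x :- k :* y) refl κ _ _)
        (cong (λ e → κ * (+ suc j) ^ (r ∸ 1) - κ * (+ suc j) ^ e) (sym s∸1≡))

  integerPart-congruence : ∀ {p} → Prime p → ∀ {a r s} w → a < r ∸ 1 →
    s ∸ 1 ≡ r ∸ 1 ℕ.+ φ p a ℕ.* w → ∀ n → (+ p) ^ suc a ∣ℤ E-integerPart p r n - E-integerPart p s n
  integerPart-congruence {p} pp {a} {r} {s} w a<r∸1 s∸1≡ n = subst (_ ∣ℤ_) eq
    (ℤ.∣m∣n⇒∣m+n (ℤ.∣m∣n⇒∣m-n (n!S-congruence pp {r = r} {s} w a<r∸1 s∸1≡ n)
                               (ℤ.∣m⇒∣m*n (n!S r n) (^-mono-∣ ℤ.∣-refl a<r)))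
                 (ℤ.∣m⇒∣m*n (n!S s n) (^-mono-∣ ℤ.∣-refl a<s)))
    where
    a<r : a < r
    a<r = ℕ.<-≤-trans a<r∸1 (ℕ.m∸n≤m r 1)
    a<s : a < s
    a<s = ℕ.<-≤-trans a<r∸1 (ℕ.≤-trans (ℕ.m≤m+n (r ∸ 1) _)
                                        (ℕ.≤-trans (ℕ.≤-reflexive (sym s∸1≡)) (ℕ.m∸n≤m s 1)))
    eq : n!S r n - n!S s n - (+ p) ^ r * n!S r n + (+ p) ^ s * n!S s n ≡
         E-integerPart p r n - E-integerPart p s n
    eq = solve 4 (λ x y u v → x :- y :- u :* x :+ v :* y := (con 1ℤ :- u) :* x :- (con 1ℤ :- v) :* y)
           refl (n!S r n) (n!S s n) ((+ p) ^ r) ((+ p) ^ s)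

  E-congruence : ∀ {p l e d} t k → Prime p → 0 < l → k ! ℕ.* 24 ℕ.^ k ≡ p ℕ.^ e ℕ.* d → p ∤ d →
    ∀ {a b} → a ≤ b → ∀ n →
    CongQ p (+ a + - + e + + 1) (E p t k (φ p a ℕ.+ l) n) (E p t k (φ p b ℕ.+ l) n)
  E-congruence {p} {l} {e} {d} t k pp 0<l k!*24^k≡pᵉd p∤d {a} {b} a≤b n
    with w , s∸1≡ ← [φ[b]+l]∸1≡[φ[a]+l]∸1+φ[a]*w (prime⇒1<p pp) 0<l a≤b
    with ℤ.divides c eq ← integerPart-congruence pp {r = φ p a ℕ.+ l} {φ p b ℕ.+ l} w
                            (a<[φ+l]∸1 (prime⇒1<p pp) 0<l a) s∸1≡ n =
    subst₂ (PowDiv p) ([1+a]⊖e≡a-e+1 a e)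
      (sym (E-difference p t k (φ p a ℕ.+ l) (φ p b ℕ.+ l) n c (suc a) eq))
      (PowDiv-intro {u = E-coefficientNumerator t k} c (suc a) e p∤d
        (coefficient*d*pᵉ≡numerator {p} {e} {d} t k k!*24^k≡pᵉd))

open import Data.Nat using (_+_; _*_; _^_; _/_)

lemma3p7 : (t l p k : ℕ) → Odd t → Odd l → Prime p → Odd p → k ≤ t / 2 →
    Σ ℤ λ x → (a b n : ℕ) → a ≤ b →
      CongQ p ((+ a) ℤ.+ x ℤ.+ (+ 1))
        (E p t k (p ^ a * (p ∸ 1) + l) n)
        (E p t k (p ^ b * (p ∸ 1) + l) n)
lemma3p7 t l p k _ (h , l≡2h+1) pp _ _
  with e , d , k!*24^k≡pᵉd , p∤d ←
         p-adicDecomposition p {{prime⇒nonTrivial pp}} (k ! * 24 ^ k) {{k!*24^k≢0 k}} =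
  ℤ.- (+ e) , λ a b n a≤b → E-congruence {l = l} {e} {d} t k pp 0<l k!*24^k≡pᵉd p∤d a≤b n
  where
  0<l : 0 < l
  0<l = subst (0 <_) (sym l≡2h+1) (ℕ.m≤n+m 1 (2 * h))
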